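{- Let $m\ge 2$, $n\ge 1$ and let $C$ be an $m\times n$ maximal configuration resistant to predators. If row $m-1$ of $C$ contains exactly $r$ occupied lots, then every row $i$ with $1\le i\le m-2$ contains at most $r+1$ occupied lots.
   Context: An $m\times n$ configuration is a $0$-$1$ matrix $C=(C_{i,j})$, $1\le i\le m$, $1\le j\le n$; row $1$ is the northernmost and row $m$ the southernmost, column $1$ the westernmost and column $n$ the easternmost; $C_{i,j}=1$ means lot $(i,j)$ is occupied by a house. A house at $(i,j)$ is blocked if $j>1$ and $C_{i,j-1}=1$, and $j<n$ and $C_{i,j+1}=1$, and $i<m$ and $C_{i+1,j}=1$. $C$ is permissible if no house is blocked; it is maximal if it is permissible and occupying any single empty lot yields a non-permissible configuration. A maximal configuration is resistant to predators if for every empty lot $(i,j)$, after setting $C_{i,j}=1$ the new house at $(i,j)$ is blocked. -}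

module Defs where

open import Data.Nat using (ℕ; zero; suc; _+_; _≤_; _<_)
open import Data.Fin using (Fin; toℕ; _≟_)
open import Data.Bool using (Bool; true; false; if_then_else_)
open import Data.Product using (Σ; _×_; ∃-syntax)
open import Data.List using (List; length; filterᵇ)
open import Data.List using () renaming (map to lmap)
open import Data.Fin using () renaming (_≟_ to _≟ᶠ_)
open import Relation.Binary.PropositionalEquality using (_≡_)
open import Relation.Nullary using (¬_; does)
open import Data.List using (allFin)

-- An m×n configuration: C i j ≡ true means lot (i,j) is occupied.
-- Rows/columns are 0-indexed here: Fin index i corresponds to paper row i+1
-- (row 0 = northernmost), column 0 = westernmost.
Config : ℕ → ℕ → Set
Config m n = Fin m → Fin n → Bool

Blocked : ∀ {m n} → Config m n → Fin m → Fin n → Set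
Blocked {m} {n} C i j =
  (∃[ j' ] (suc (toℕ j') ≡ toℕ j × C i j' ≡ true)) ×
  (∃[ j' ] (toℕ j' ≡ suc (toℕ j) × C i j' ≡ true)) ×
  (∃[ i' ] (toℕ i' ≡ suc (toℕ i) × C i' j ≡ true))

Permissible : ∀ {m n} → Config m n → Set
Permissible C = ∀ i j → C i j ≡ true → ¬ Blocked C i j

occupy : ∀ {m n} → Config m n → Fin m → Fin n → Config m n
occupy C i j i' j' =
  if does (i ≟ᶠ i') then (if does (j ≟ᶠ j') then true else C i' j') else C i' j'

Maximal : ∀ {m n} → Config m n → Set
Maximal C = Permissible C × (∀ i j → C i j ≡ false → ¬ Permissible (occupy C i j))

ResistantToPredators : ∀ {m n} → Config m n → Set
ResistantToPredators C =
  Maximal C × (∀ i j → C i j ≡ false → Blocked (occupy C i j) i j)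

rowCount : ∀ {m n} → Config m n → Fin m → ℕ
rowCount {n = n} C i = length (filterᵇ (λ j → C i j) (allFin n))

{-# OPTIONS --safe #-}
-- Compare rows through  Ψ(a) = 2·#(empty lots of a) + [lot 2 of a occupied] + [lot n−1 of a occupied]
-- (rowPotential).
-- In two consecutive rows of a configuration resistant to predators, every empty lot has occupied
-- neighbours to the west, east and south, and an occupied upper lot whose southern neighbour is occupied
-- has an empty western or eastern neighbour.  So between any two empty lots of the lower row there is an
-- empty lot of the upper row; a potential carried along the two-row strip turns this into
-- Ψ(lower) ≤ Ψ(upper).  Hence Ψ decreases southwards, and for row i north of row i₀
-- 2·#empty(i₀) ≤ Ψ(i₀) ≤ Ψ(i) ≤ 2·#empty(i) + 2.
module Submission where

open import Defs
open import Data.Nat using (ℕ; zero; suc; _+_; _*_; _≤_; _<_; z≤n; s≤s; s<s; s<s⁻¹)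
open import Data.Nat.Properties
  using ( +-comm; +-assoc; +-identityʳ; +-suc; *-zeroʳ; *-distribˡ-+; +-commutativeSemigroup
        ; ≤-refl; ≤-reflexive; ≤-trans; <⇒≤; <-irrefl; m≤m+n; m+n≤o⇒n≤o; m<n⇒m<1+n
        ; +-mono-≤; +-monoʳ-≤; +-cancelʳ-≤; *-cancelˡ-≤; suc-injective; 0≢1+n; 1+n≢n; module ≤-Reasoning )
open import Data.Nat.Tactic.RingSolver using (solve-∀)
open import Algebra.Properties.CommutativeSemigroup +-commutativeSemigroup using (x∙yz≈y∙xz; x∙yz≈yx∙z)
open import Data.Fin using (Fin; toℕ; fromℕ; fromℕ<; _≟_) renaming (zero to fzero; suc to fsuc)
open import Data.Fin.Properties using (toℕ-injective; toℕ-fromℕ; toℕ-fromℕ<; toℕ<n)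
open import Data.Bool using (Bool; true; false)
open import Data.Bool.Properties using (¬-not)
open import Data.Empty using (⊥; ⊥-elim)
open import Data.Product using (_,_; proj₁; proj₂)
open import Data.Sum using (_⊎_; inj₁; inj₂; [_,_])
open import Data.List using (length; filterᵇ; tabulate)
open import Function using (_∘_; id)
open import Relation.Nullary using (¬_; yes; no)
open import Relation.Binary.PropositionalEquality using (_≡_; _≢_; refl; sym; trans; cong; cong₂; subst; subst₂)

∑ : ℕ → (ℕ → ℕ) → ℕ
∑ zero    u = 0
∑ (suc k) u = u 0 + ∑ k (u ∘ suc)

∑-snoc : ∀ k (u : ℕ → ℕ) → ∑ (suc k) u ≡ ∑ k u + u k
∑-snoc zero    u = +-comm (u 0) 0
∑-snoc (suc k) u rewrite ∑-snoc k (u ∘ suc) = sym (+-assoc (u 0) _ _)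

∑-scale : ∀ c k (u : ℕ → ℕ) → ∑ k (λ j → c * u j) ≡ c * ∑ k u
∑-scale c zero    u = sym (*-zeroʳ c)
∑-scale c (suc k) u rewrite ∑-scale c k (u ∘ suc) = sym (*-distribˡ-+ c (u 0) _)

telescope : ∀ k (u v p : ℕ → ℕ) → (∀ j → j < k → v j + p (suc j) ≤ u j + p j) →
            ∑ k v + p k ≤ ∑ k u + p 0
telescope zero    u v p step = ≤-refl
telescope (suc k) u v p step = begin
  v 0 + ∑ k (v ∘ suc) + p (suc k)   ≡⟨ +-assoc (v 0) _ _ ⟩
  v 0 + (∑ k (v ∘ suc) + p (suc k)) ≤⟨ +-monoʳ-≤ (v 0) shifted ⟩
  v 0 + (∑ k (u ∘ suc) + p 1)       ≡⟨ x∙yz≈y∙xz (v 0) (∑ k (u ∘ suc)) (p 1) ⟩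
  ∑ k (u ∘ suc) + (v 0 + p 1)       ≤⟨ +-monoʳ-≤ (∑ k (u ∘ suc)) (step 0 (s≤s z≤n)) ⟩
  ∑ k (u ∘ suc) + (u 0 + p 0)       ≡⟨ x∙yz≈yx∙z (∑ k (u ∘ suc)) (u 0) (p 0) ⟩
  u 0 + ∑ k (u ∘ suc) + p 0         ∎
  where
  open ≤-Reasoning
  shifted : ∑ k (v ∘ suc) + p (suc k) ≤ ∑ k (u ∘ suc) + p 1
  shifted = telescope k (u ∘ suc) (v ∘ suc) (p ∘ suc) (λ j j<k → step (suc j) (s≤s j<k))

gap : Bool → ℕ
gap true  = 0
gap false = 1

filled : Bool → ℕ
filled true  = 1
filled false = 0

filled≤1 : ∀ b → filled b ≤ 1
filled≤1 true  = ≤-refl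
filled≤1 false = z≤n

gaps : ℕ → (ℕ → Bool) → ℕ
gaps n a = ∑ n (gap ∘ a)

gaps-interior : ∀ k (a : ℕ → Bool) → a 0 ≡ true → a (suc k) ≡ true →
                gaps (suc (suc k)) a ≡ gaps k (a ∘ suc)
gaps-interior k a a₀ aₖ₊₁ rewrite a₀ | ∑-snoc k (gap ∘ a ∘ suc) | aₖ₊₁ = +-identityʳ _

either-false : ∀ {a b : Bool} → (a ≡ true → b ≡ true → ⊥) → a ≡ false ⊎ b ≡ false
either-false {false}        _ = inj₁ refl
either-false {true} {false} _ = inj₂ refl
either-false {true} {true}  h = ⊥-elim (h refl refl)

record Column : Set where
  constructor col
  field
    top bottom : Bool

open Column

full : Column
full = col true true

columns : (ℕ → Bool) → (ℕ → Bool) → ℕ → Column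
columns a b j = col (a j) (b j)

record Admissible (x y z : Column) : Set where
  field
    south-of-top-gap   : top y ≡ false → bottom y ≡ true
    west-of-bottom-gap : bottom y ≡ false → bottom x ≡ true
    top-unblocked      : top y ≡ true → bottom y ≡ true → top x ≡ false ⊎ top z ≡ false

-- Credit carried eastwards along a strip, each lower gap costing 2 and each upper gap earning 2.  It is 2
-- just after an upper gap and 0 just after a lower one; at a full column it looks ahead, since a full
-- column not preceded by an upper gap is followed by one.
stripPotential : Column → Column → ℕ
stripPotential (col false _)    _                = 2
stripPotential (col true false) _                = 0
stripPotential (col true true)  (col false _)    = 0
stripPotential (col true true)  (col true true)  = 1
stripPotential (col true true)  (col true false) = 2

stripPotential≤2 : ∀ x y → stripPotential x y ≤ 2
stripPotential≤2 (col false _)    _                = ≤-refl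
stripPotential≤2 (col true false) _                = z≤n
stripPotential≤2 (col true true)  (col false _)    = z≤n
stripPotential≤2 (col true true)  (col true true)  = s≤s z≤n
stripPotential≤2 (col true true)  (col true false) = ≤-refl

stripPotential-step : ∀ {x y z} → Admissible x y z →
  2 * gap (bottom y) + stripPotential y z ≤ 2 * gap (top y) + stripPotential x y
stripPotential-step {y = col false true} _ = s≤s (s≤s z≤n)
stripPotential-step {y = col false false} adm with Admissible.south-of-top-gap adm refl
... | ()
stripPotential-step {col false true} {col true false} _ = ≤-refl
stripPotential-step {col true true}  {col true false} _ = ≤-refl
stripPotential-step {col _ false}    {col true false} adm with Admissible.west-of-bottom-gap adm refl
... | ()
stripPotential-step {x} {col true true} {z} adm with Admissible.top-unblocked adm refl refl
stripPotential-step {col false _} {col true true} {z} _ | inj₁ refl = stripPotential≤2 full z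
stripPotential-step {x} {col true true} {col false _} _ | inj₂ refl = z≤n

stripPotential-west : ∀ y → stripPotential full y + filled (bottom y) ≤ 1 + filled (top y)
stripPotential-west (col false false) = z≤n
stripPotential-west (col false true)  = ≤-refl
stripPotential-west (col true  false) = ≤-refl
stripPotential-west (col true  true)  = ≤-refl

stripPotential-east : ∀ y → 1 + filled (bottom y) ≤ stripPotential y full + filled (top y)
stripPotential-east (col false false) = s≤s z≤n
stripPotential-east (col false true)  = ≤-refl
stripPotential-east (col true  false) = ≤-refl
stripPotential-east (col true  true)  = ≤-refl

rowPotential : ℕ → (ℕ → Bool) → ℕ
rowPotential k a = 2 * gaps (suc (suc k)) a + filled (a 1) + filled (a k)

rowPotential-lower : ∀ k a → 2 * gaps (suc (suc k)) a ≤ rowPotential k a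
rowPotential-lower k a = ≤-trans (m≤m+n _ _) (m≤m+n _ _)

rowPotential-upper : ∀ k a → rowPotential k a ≤ 2 * suc (gaps (suc (suc k)) a)
rowPotential-upper k a = begin
  rowPotential k a                         ≤⟨ +-mono-≤ (+-monoʳ-≤ (2 * g) (filled≤1 (a 1))) (filled≤1 (a k)) ⟩
  2 * g + 1 + 1                            ≡⟨ double-suc g ⟩
  2 * suc g                                ∎
  where
  open ≤-Reasoning
  g : ℕ
  g = gaps (suc (suc k)) a
  double-suc : ∀ g → 2 * g + 1 + 1 ≡ 2 * suc g
  double-suc = solve-∀

stripPotential-telescope : ∀ k (c : ℕ → Column) →
  (∀ j → j < k → Admissible (c j) (c (suc j)) (c (suc (suc j)))) →
  2 * gaps k (bottom ∘ c ∘ suc) + stripPotential (c k) (c (suc k)) ≤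
  2 * gaps k (top ∘ c ∘ suc) + stripPotential (c 0) (c 1)
stripPotential-telescope k c adm =
  subst₂ _≤_ (cong (_+ p k) (∑-scale 2 k (gap ∘ bottom ∘ c ∘ suc))) (cong (_+ p 0) (∑-scale 2 k (gap ∘ top ∘ c ∘ suc)))
    (telescope k (λ j → 2 * gap (top (c (suc j)))) (λ j → 2 * gap (bottom (c (suc j)))) p
               (λ j j<k → stripPotential-step (adm j j<k)))
  where
  p : ℕ → ℕ
  p j = stripPotential (c j) (c (suc j))

combine-boundaries : ∀ x y {l r a₁ aₖ b₁ bₖ} →
  y + r ≤ x + l → l + b₁ ≤ 1 + a₁ → 1 + bₖ ≤ r + aₖ → y + b₁ + bₖ ≤ x + a₁ + aₖ
combine-boundaries x y {l} {r} {a₁} {aₖ} {b₁} {bₖ} strip west east =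
  +-cancelʳ-≤ (l + r + 1) _ _ (begin
    y + b₁ + bₖ + (l + r + 1)       ≡⟨ regroup y b₁ bₖ l r ⟩
    y + r + (l + b₁) + (1 + bₖ)     ≤⟨ +-mono-≤ (+-mono-≤ strip west) east ⟩
    x + l + (1 + a₁) + (r + aₖ)     ≡⟨ regroup′ x a₁ aₖ l r ⟩
    x + a₁ + aₖ + (l + r + 1)       ∎)
  where
  open ≤-Reasoning
  regroup : ∀ y b₁ bₖ l r → y + b₁ + bₖ + (l + r + 1) ≡ y + r + (l + b₁) + (1 + bₖ)
  regroup = solve-∀
  regroup′ : ∀ x a₁ aₖ l r → x + l + (1 + a₁) + (r + aₖ) ≡ x + a₁ + aₖ + (l + r + 1)
  regroup′ = solve-∀

rowPotential-bottom≤top : ∀ k (a b : ℕ → Bool) →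
  columns a b 0 ≡ full → columns a b (suc k) ≡ full →
  (∀ j → j < k → Admissible (columns a b j) (columns a b (suc j)) (columns a b (suc (suc j)))) →
  rowPotential k b ≤ rowPotential k a
rowPotential-bottom≤top k a b e₀ eₖ₊₁ adm =
  combine-boundaries (2 * gaps (suc (suc k)) a) (2 * gaps (suc (suc k)) b)
    strip (stripPotential-west (c 1)) (stripPotential-east (c k))
  where
  c : ℕ → Column
  c = columns a b
  strip : 2 * gaps (suc (suc k)) b + stripPotential (c k) full ≤ 2 * gaps (suc (suc k)) a + stripPotential full (c 1)
  strip rewrite gaps-interior k a (cong top e₀) (cong top eₖ₊₁) | gaps-interior k b (cong bottom e₀) (cong bottom eₖ₊₁) =
    subst₂ (λ e w → 2 * gaps k (b ∘ suc) + stripPotential (c k) e ≤ 2 * gaps k (a ∘ suc) + stripPotential w (c 1))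
           eₖ₊₁ e₀ (stripPotential-telescope k c adm)

antitone-by-steps : ∀ {m} (f : Fin m → ℕ) → (∀ {t t'} → toℕ t' ≡ suc (toℕ t) → f t' ≤ f t) →
                    ∀ {s t} → toℕ s ≤ toℕ t → f t ≤ f s
antitone-by-steps f step {fzero}  {fzero}          _         = ≤-refl
antitone-by-steps f step {fzero}  {fsuc fzero}     _         = step {fzero} refl
antitone-by-steps f step {fzero}  {fsuc (fsuc t)}  _         =
  ≤-trans (antitone-by-steps (f ∘ fsuc) (step ∘ cong suc) {fzero} {fsuc t} z≤n) (step {fzero} refl)
antitone-by-steps f step {fsuc s} {fsuc t}         (s≤s s≤t) = antitone-by-steps (f ∘ fsuc) (step ∘ cong suc) s≤t

-- Row i as a sequence; positions ≥ n are junk (read as occupied) and never inspected.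
extend : ∀ {n} → (Fin n → Bool) → ℕ → Bool
extend {zero}  f j       = true
extend {suc n} f zero    = f fzero
extend {suc n} f (suc j) = extend (f ∘ fsuc) j

extend-toℕ : ∀ {n} (f : Fin n → Bool) {j} (x : Fin n) → toℕ x ≡ j → extend f j ≡ f x
extend-toℕ f fzero    refl = refl
extend-toℕ f (fsuc x) refl = extend-toℕ (f ∘ fsuc) x refl

length-filter+gaps : ∀ {A : Set} n (h : Fin n → A) (p : A → Bool) →
                     length (filterᵇ p (tabulate h)) + gaps n (extend (p ∘ h)) ≡ n
length-filter+gaps zero    h p = refl
length-filter+gaps (suc n) h p with p (h fzero) | length-filter+gaps n (h ∘ fsuc) p
... | true  | ih = cong suc ih
... | false | ih = trans (+-suc _ _) (cong suc ih)

rowCount+gaps : ∀ {m n} (C : Config m n) i → rowCount C i + gaps n (extend (C i)) ≡ n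
rowCount+gaps {n = n} C i = length-filter+gaps n id (C i)

rowCount≤width : ∀ {m n} (C : Config m n) i → rowCount C i ≤ n
rowCount≤width C i = ≤-trans (m≤m+n _ _) (≤-reflexive (rowCount+gaps C i))

occupy-elsewhere : ∀ {m n} (C : Config m n) {i j i' j'} → i ≢ i' ⊎ j ≢ j' → occupy C i j i' j' ≡ C i' j'
occupy-elsewhere C {i} {j} {i'} {j'} ne with i ≟ i' | j ≟ j'
... | no _     | _        = refl
... | yes _    | no _     = refl
... | yes refl | yes refl = ⊥-elim ([ (λ i≢i → i≢i refl) , (λ j≢j → j≢j refl) ] ne)

blocked-before-occupy : ∀ {m n} (C : Config m n) {i j} → Blocked (occupy C i j) i j → Blocked C i j
blocked-before-occupy C {i} {j} ((w , ew , cw) , (e , ee , ce) , (s , es , cs)) =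
    (w , ew , unchanged (inj₂ (λ { refl → 1+n≢n ew })) cw)
  , (e , ee , unchanged (inj₂ (λ { refl → 1+n≢n (sym ee) })) ce)
  , (s , es , unchanged (inj₁ (λ { refl → 1+n≢n (sym es) })) cs)
  where
  unchanged : ∀ {i' j'} → i ≢ i' ⊎ j ≢ j' → occupy C i j i' j' ≡ true → C i' j' ≡ true
  unchanged ne = trans (sym (occupy-elsewhere C ne))

module _ {m k} {C : Config m (suc (suc k))} (resistant : ResistantToPredators C) where

  private
    row : Fin m → ℕ → Bool
    row i = extend (C i)

    empty⇒blocked : ∀ {i x} → C i x ≡ false → Blocked C i x
    empty⇒blocked {i} {x} e = blocked-before-occupy C (proj₂ resistant i x e)

    occupied⇒unblocked : ∀ {i x} → C i x ≡ true → ¬ Blocked C i x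
    occupied⇒unblocked {i} {x} = proj₁ (proj₁ resistant) i x

    west-border-full : ∀ i → row i 0 ≡ true
    west-border-full i = ¬-not {y = false} λ e →
      let ((_ , ew , _) , _) = empty⇒blocked e in 0≢1+n (sym ew)

    east-border-full : ∀ i → row i (suc k) ≡ true
    east-border-full i = trans (extend-toℕ (C i) (fromℕ (suc k)) (toℕ-fromℕ (suc k))) (¬-not {y = false} λ e →
      let (_ , (x₂ , ex₂ , _) , _) = empty⇒blocked e
      in <-irrefl (trans ex₂ (cong suc (toℕ-fromℕ (suc k)))) (toℕ<n x₂))

    south-of-gap : ∀ {i i' x} → toℕ i' ≡ suc (toℕ i) → C i x ≡ false → C i' x ≡ true
    south-of-gap {x = x} i'-next e =
      let (_ , _ , (s , es , cs)) = empty⇒blocked e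
      in subst (λ t → C t x ≡ true) (toℕ-injective (trans es (sym i'-next))) cs

    west-of-gap : ∀ {i x j} → toℕ x ≡ suc j → C i x ≡ false → row i j ≡ true
    west-of-gap {i} x-at e =
      let ((w , ew , cw) , _) = empty⇒blocked e
      in trans (extend-toℕ (C i) w (suc-injective (trans ew x-at))) cw

    unblocked : ∀ {i i' x j} → toℕ i' ≡ suc (toℕ i) → toℕ x ≡ suc j → suc (suc j) < suc (suc k) →
                C i x ≡ true → C i' x ≡ true → row i j ≡ false ⊎ row i (suc (suc j)) ≡ false
    unblocked {i} {i'} {x} {j} i'-next x-at 2+j<n o o' = either-false λ o₀ o₂ → occupied⇒unblocked o
      ( (x₀ , trans (cong suc toℕ-x₀) (sym x-at) , trans (sym (extend-toℕ (C i) x₀ toℕ-x₀)) o₀)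
      , (x₂ , trans toℕ-x₂ (cong suc (sym x-at)) , trans (sym (extend-toℕ (C i) x₂ toℕ-x₂)) o₂)
      , (i' , i'-next , o') )
      where
      j<n : j < suc (suc k)
      j<n = m+n≤o⇒n≤o 2 2+j<n
      x₀ x₂ : Fin (suc (suc k))
      x₀ = fromℕ< j<n
      x₂ = fromℕ< 2+j<n
      toℕ-x₀ : toℕ x₀ ≡ j
      toℕ-x₀ = toℕ-fromℕ< j<n
      toℕ-x₂ : toℕ x₂ ≡ suc (suc j)
      toℕ-x₂ = toℕ-fromℕ< 2+j<n

    admissible : ∀ {i i'} → toℕ i' ≡ suc (toℕ i) → ∀ j → j < k →
      let c = columns (row i) (row i') in Admissible (c j) (c (suc j)) (c (suc (suc j)))
    admissible {i} {i'} i'-next j j<k = record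
      { south-of-top-gap   = λ e → trans (middle i') (south-of-gap i'-next (trans (sym (middle i)) e))
      ; west-of-bottom-gap = λ e → west-of-gap toℕ-x (trans (sym (middle i')) e)
      ; top-unblocked      = λ o o' → unblocked i'-next toℕ-x (s<s (s<s j<k))
                                        (trans (sym (middle i)) o) (trans (sym (middle i')) o')
      }
      where
      1+j<n : suc j < suc (suc k)
      1+j<n = s<s (m<n⇒m<1+n j<k)
      x : Fin (suc (suc k))
      x = fromℕ< 1+j<n
      toℕ-x : toℕ x ≡ suc j
      toℕ-x = toℕ-fromℕ< 1+j<n
      middle : ∀ t → row t (suc j) ≡ C t x
      middle t = extend-toℕ (C t) x toℕ-x

    rowPotential-antitone : ∀ {i i'} → toℕ i ≤ toℕ i' → rowPotential k (row i') ≤ rowPotential k (row i)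
    rowPotential-antitone = antitone-by-steps (rowPotential k ∘ row) λ {i} {i'} i'-next →
      rowPotential-bottom≤top k (row i) (row i')
        (cong₂ col (west-border-full i) (west-border-full i'))
        (cong₂ col (east-border-full i) (east-border-full i'))
        (admissible i'-next)

  rowCount≤suc-rowCount-south : ∀ {i i'} → toℕ i ≤ toℕ i' → rowCount C i ≤ suc (rowCount C i')
  rowCount≤suc-rowCount-south {i} {i'} i≤i' = +-cancelʳ-≤ g _ _ (begin
    rowCount C i + g           ≡⟨ trans (rowCount+gaps C i) (sym (rowCount+gaps C i')) ⟩
    rowCount C i' + g'         ≤⟨ +-monoʳ-≤ (rowCount C i') g'≤1+g ⟩
    rowCount C i' + suc g      ≡⟨ +-suc (rowCount C i') g ⟩
    suc (rowCount C i') + g    ∎)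
    where
    open ≤-Reasoning
    g g' : ℕ
    g  = gaps (suc (suc k)) (row i)
    g' = gaps (suc (suc k)) (row i')
    g'≤1+g : g' ≤ suc g
    g'≤1+g = *-cancelˡ-≤ 2 (≤-trans (rowPotential-lower k (row i'))
                           (≤-trans (rowPotential-antitone i≤i') (rowPotential-upper k (row i))))

lemma5p2 : (m n : ℕ) → 2 ≤ m → 1 ≤ n → (C : Config m n) →
    ResistantToPredators C →
    (r : ℕ) → (i₀ : Fin m) → suc (suc (toℕ i₀)) ≡ m → rowCount C i₀ ≡ r →
    (i : Fin m) → suc (suc (toℕ i)) < m → rowCount C i ≤ suc r
lemma5p2 m zero _ () C _ r i₀ _ _ i _
lemma5p2 m (suc zero) _ _ C _ r i₀ _ _ i _ = ≤-trans (rowCount≤width C i) (s≤s z≤n)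
lemma5p2 m (suc (suc k)) _ _ C resistant _ i₀ i₀-penultimate refl i i-above =
  rowCount≤suc-rowCount-south resistant
    (<⇒≤ (s<s⁻¹ (s<s⁻¹ (subst (suc (suc (toℕ i)) <_) (sym i₀-penultimate) i-above))))
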